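{- Let $n$ be an even positive integer and let $(X, \varphi)$ be a $\mathbb{Z}_n$-voltage pregraph, $X = (D, V; \mathrm{beg}, \mathrm{inv})$. Let $a, b \in V$ be distinct vertices and let $\delta \in D$ be a dart with $\mathrm{beg}\,\delta = a$, $\mathrm{beg}(\mathrm{inv}\,\delta) = b$ and $\varphi(\delta) = \gamma \in \mathbb{Z}_n$. Let $(X_1, \varphi_1)$ be the $\mathbb{Z}_n$-voltage pregraph obtained from $(X,\varphi)$ by deleting the darts $\delta$ and $\mathrm{inv}\,\delta$, adding three new vertices $c, d, e$, and adding the following new darts with voltages: a dart from $a$ to $c$ with voltage $\gamma$ (and its inverse from $c$ to $a$ with voltage $-\gamma$); a dart from $d$ to $c$ with voltage $n/2$ (and its inverse with voltage $n/2$); a dart from $e$ to $d$ with voltage $\gamma$ (inverse $-\gamma$); a dart from $e$ to $b$ with voltage $\gamma$ (inverse $-\gamma$); and one semi-edge (a dart equal to its own inverse) at each of $c$, $d$, $e$, each with voltage $n/2$. Suppose that the derived graph $G$ of $(X,\varphi)$ is a nut graph and that in $G$ the $a$-orbit and the $b$-orbit have different magnitudes. Then the derived graph of $(X_1, \varphi_1)$ is a nut graph.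
   Context: A pregraph is a quadruple $X = (D, V; \mathrm{beg}, \mathrm{inv})$, where $D$ (darts) and $V \neq \varnothing$ (vertices) are disjoint finite sets, $\mathrm{beg}\colon D \to V$ assigns to each dart its initial vertex, and $\mathrm{inv}\colon D \to D$ is an involution assigning to each dart its inverse (semi-edges, loops and parallel edges are allowed). A $\mathbb{Z}_n$-voltage pregraph is a pair $(X,\varphi)$ with $\varphi\colon D \to \mathbb{Z}_n$ and $\varphi(\mathrm{inv}\,a) = -\varphi(a)$. Its derived graph is the pregraph with vertex set $V \times \mathbb{Z}_n$, dart set $D \times \mathbb{Z}_n$, $\mathrm{beg}_1(a,j) = (\mathrm{beg}\,a, j)$ and $\mathrm{inv}_1(a,j) = (\mathrm{inv}\,a, \varphi(a) + j)$; thus each dart from $x$ to $y$ with voltage $\gamma$ yields the adjacencies $(x,j) \sim (y, j+\gamma)$. A nut graph is a simple graph with at least two vertices whose adjacency matrix has a one-dimensional null space spanned by a vector with no zero entries. For $v \in V$, the $v$-orbit of the derived graph $G$ is $\{(v,j) : j \in \mathbb{Z}_n\}$. If $G$ is a nut graph and $u$ is a nonzero vector in the null space of its adjacency matrix, then $|u((v,j))|$ does not depend on $j$; this common value is the magnitude of the $v$-orbit (with respect to $u$), and whether two orbits have different magnitudes does not depend on the choice of $u$. -}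

module Defs where

open import Data.Nat as ℕ using (ℕ; zero; suc; _∸_; _≤_; _<_; NonZero)
open import Data.Nat.DivMod using (_mod_; _/_)
open import Data.Fin as Fin using (Fin; zero; suc; toℕ; combine; remQuot; splitAt; _↑ʳ_)
open import Data.Rational as ℚ using (ℚ; 0ℚ; 1ℚ; _+_; _*_; ∣_∣)
open import Data.Bool using (Bool; if_then_else_; _∧_)
open import Data.Product using (_×_; _,_; ∃; proj₁; proj₂)
open import Data.Sum using (inj₁; inj₂)
open import Relation.Nullary using (¬_)
open import Relation.Nullary.Decidable using (⌊_⌋)
open import Relation.Binary.PropositionalEquality using (_≡_; _≢_)

record PreStructure : Set where
  field
    nD  : ℕ
    nV  : ℕ
    beg : Fin nD → Fin nV
    inv : Fin nD → Fin nD
open PreStructure public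

IsPregraph : PreStructure → Set
IsPregraph X = (0 < nV X) × (∀ d → inv X (inv X d) ≡ d)

module _ (n : ℕ) .{{_ : NonZero n}} where
  _+ₙ_ : Fin n → Fin n → Fin n
  x +ₙ y = (toℕ x ℕ.+ toℕ y) mod n

  -ₙ_ : Fin n → Fin n
  -ₙ x = (n ∸ toℕ x) mod n

  halfₙ : Fin n
  halfₙ = (n / 2) mod n

IsVoltage : (X : PreStructure) (n : ℕ) .{{_ : NonZero n}} → (Fin (nD X) → Fin n) → Set
IsVoltage X n φ = ∀ d → φ (inv X d) ≡ -ₙ_ n (φ d)

-- Derived graph: vertex (v , j) is  combine v j : Fin (nV * n),
-- dart (a , j) is combine a j : Fin (nD * n).

derived : (X : PreStructure) (n : ℕ) .{{_ : NonZero n}} → (Fin (nD X) → Fin n) → PreStructure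
derived X n φ = record
  { nD  = nD X ℕ.* n
  ; nV  = nV X ℕ.* n
  ; beg = λ k → let (a , j) = remQuot {nD X} n k in combine (beg X a) j
  ; inv = λ k → let (a , j) = remQuot {nD X} n k in combine (inv X a) (_+ₙ_ n (φ a) j)
  }

Σ : ∀ {m} → (Fin m → ℚ) → ℚ
Σ {zero}  f = 0ℚ
Σ {suc m} f = f zero + Σ (λ i → f (suc i))

Simple : PreStructure → Set
Simple G = (∀ d → inv G d ≢ d)
         × (∀ d → beg G d ≢ beg G (inv G d))
         × (∀ d d' → beg G d ≡ beg G d' → beg G (inv G d) ≡ beg G (inv G d') → d ≡ d')

adj : (G : PreStructure) → Fin (nV G) → Fin (nV G) → ℚ
adj G u v = Σ (λ d → if ⌊ beg G d Fin.≟ u ⌋ ∧ ⌊ beg G (inv G d) Fin.≟ v ⌋ then 1ℚ else 0ℚ)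

InKernel : (G : PreStructure) → (Fin (nV G) → ℚ) → Set
InKernel G x = ∀ u → Σ (λ v → adj G u v * x v) ≡ 0ℚ

IsNut : PreStructure → Set
IsNut G = (2 ≤ nV G) × Simple G
        × ∃ λ (u : Fin (nV G) → ℚ) → (∀ v → u v ≢ 0ℚ) × InKernel G u
            × (∀ x → InKernel G x → ∃ λ (c : ℚ) → ∀ v → x v ≡ c * u v)

-- The a-orbit and b-orbit of the derived graph G have different magnitudes
-- (w.r.t. some nonzero null vector; independent of the choice).
DifferentMagnitudes : (X : PreStructure) (n : ℕ) .{{_ : NonZero n}} (φ : Fin (nD X) → Fin n)
                      (a b : Fin (nV X)) → Set
DifferentMagnitudes X n φ a b =
  ∃ λ (u : Fin (nV X ℕ.* n) → ℚ) → InKernel (derived X n φ) u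
    × (∃ λ w → u w ≢ 0ℚ)
    × ∃ λ (j : Fin n) → ∣ u (combine a j) ∣ ≢ ∣ u (combine b j) ∣

-- Vertices: Fin (3 + nV); zero = c, 1 = d, 2 = e, old v ↦ 3 ↑ʳ v.
-- Darts: Fin (9 + nD); old dart x ↦ 9 ↑ʳ x; new darts 0..8:
--   0 : d→c (n/2)   1 : c→d (n/2)      (0,1 inverse)
--   2 : e→d (γ)     3 : d→e (-γ)       (2,3 inverse)
--   4 : e→b (γ)     5 : b→e (-γ)       (4,5 inverse)
--   6,7,8 : semi-edges at c,d,e (n/2)
-- The old darts δ, inv δ are re-used as the new dart a→c (voltage γ) and
-- its inverse c→a (voltage -γ): only beg(inv δ) changes, from b to c.

module Construction (X : PreStructure) (n : ℕ) .{{_ : NonZero n}}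
                    (φ : Fin (nD X) → Fin n) (δ : Fin (nD X)) (b : Fin (nV X)) where

  γ : Fin n
  γ = φ δ

  vc vd ve : Fin (3 ℕ.+ nV X)
  vc = zero
  vd = suc zero
  ve = suc (suc zero)

  old : Fin (nV X) → Fin (3 ℕ.+ nV X)
  old v = 3 ↑ʳ v

  newBeg : Fin 9 → Fin (3 ℕ.+ nV X)
  newBeg zero = vd
  newBeg (suc zero) = vc
  newBeg (suc (suc zero)) = ve
  newBeg (suc (suc (suc zero))) = vd
  newBeg (suc (suc (suc (suc zero)))) = ve
  newBeg (suc (suc (suc (suc (suc zero))))) = old b
  newBeg (suc (suc (suc (suc (suc (suc zero)))))) = vc
  newBeg (suc (suc (suc (suc (suc (suc (suc zero))))))) = vd
  newBeg (suc (suc (suc (suc (suc (suc (suc (suc zero)))))))) = ve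

  newInv : Fin 9 → Fin 9
  newInv zero = suc zero
  newInv (suc zero) = zero
  newInv (suc (suc zero)) = suc (suc (suc zero))
  newInv (suc (suc (suc zero))) = suc (suc zero)
  newInv (suc (suc (suc (suc zero)))) = suc (suc (suc (suc (suc zero))))
  newInv (suc (suc (suc (suc (suc zero))))) = suc (suc (suc (suc zero)))
  newInv i@(suc (suc (suc (suc (suc (suc _)))))) = i

  newφ : Fin 9 → Fin n
  newφ zero = halfₙ n
  newφ (suc zero) = halfₙ n
  newφ (suc (suc zero)) = γ
  newφ (suc (suc (suc zero))) = -ₙ_ n γ
  newφ (suc (suc (suc (suc zero)))) = γ
  newφ (suc (suc (suc (suc (suc zero))))) = -ₙ_ n γ
  newφ (suc (suc (suc (suc (suc (suc _)))))) = halfₙ n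

  beg₁ : Fin (9 ℕ.+ nD X) → Fin (3 ℕ.+ nV X)
  beg₁ k with splitAt 9 k
  ... | inj₁ i = newBeg i
  ... | inj₂ x = if ⌊ x Fin.≟ inv X δ ⌋ then vc else old (beg X x)

  inv₁ : Fin (9 ℕ.+ nD X) → Fin (9 ℕ.+ nD X)
  inv₁ k with splitAt 9 k
  ... | inj₁ i = Fin._↑ˡ_ (newInv i) (nD X)
  ... | inj₂ x = 9 ↑ʳ inv X x

  X₁ : PreStructure
  X₁ = record { nD = 9 ℕ.+ nD X ; nV = 3 ℕ.+ nV X ; beg = beg₁ ; inv = inv₁ }

  φ₁ : Fin (9 ℕ.+ nD X) → Fin n
  φ₁ k with splitAt 9 k
  ... | inj₁ i = newφ i
  ... | inj₂ x = φ x

open Construction public using (X₁; φ₁)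

{-# OPTIONS --safe #-}
module Submission where

-- The derived graph G is invariant under the shift j ↦ j + 1, so its null vectors can be written
-- orbit by orbit: y is a null vector iff for every vertex v and every i ∈ ℤₙ the sum, over the
-- darts p starting at v, of y (end p) (φ p + i) vanishes. For (X₁, φ₁) these equations at the
-- orbits of c, d and e force y_c = y_b, y_e = y_a and y_d j = −(y_b j + y_a (j − γ + n/2)); after
-- this substitution the equations at the old vertices are exactly those of (X, φ). Hence every
-- null vector of G₁ is the extension of a null vector of G, and the extension of the nut vector u
-- of G is a nut vector of G₁ provided its d-entries do not vanish. They do not: the shift is an
-- automorphism of G, so it multiplies u by some c with cⁿ = 1, whence |c| = 1 and |u| is
-- constant on every orbit, and then |u_a| ≠ |u_b| rules out cancellation.
-- Simplicity of a derived graph only asks that every loop of the voltage pregraph has nonzero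
-- voltage and that parallel darts have different voltages, which is checked on the new darts.

open import Defs
open import Data.Nat using (ℕ; NonZero)
open import Data.Nat.Divisibility using (_∣_)
open import Data.Fin using (Fin)
open import Relation.Binary.PropositionalEquality using (_≡_; _≢_)

open import Level using (0ℓ)
open import Function using (_∘_)
open import Data.Bool using (if_then_else_; _∧_)
open import Data.Empty using (⊥; ⊥-elim)
open import Data.Product using (_×_; _,_; proj₁; proj₂; ∃; uncurry)
open import Data.Sum using (inj₁; inj₂)
open import Data.Nat as ℕ using (zero; suc; _∸_)
import Data.Nat.Properties as ℕ
open import Data.Nat.DivMod using (_mod_; _%_; _/_; m%n<n; %-distribˡ-+; n%n≡0; m<n⇒m%n≡m; m/n*n≡m; m/n<m)
open import Data.Fin as Fin using (zero; suc; toℕ; combine; remQuot; _↑ˡ_; _↑ʳ_; splitAt; #_)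
open import Data.Fin.Properties
  using ( toℕ-injective; toℕ-fromℕ<; toℕ<n; punchInᵢ≢i; ↑ʳ-injective; splitAt-↑ˡ; join-splitAt; all?
        ; remQuot-combine; combine-remQuot; combine-surjective; combine-injective; combine-injectiveˡ; combine-injectiveʳ)
open import Data.Vec.Functional using (removeAt)
open import Data.Rational using (ℚ; 0ℚ; 1ℚ; _+_; _*_; -_; ∣_∣; 1/_; _≤_; NonNegative; nonNegative; ≢-nonZero)
import Data.Rational.Properties as ℚ
open import Data.Rational.Solver using (module +-*-Solver)
open import Algebra.Bundles using (AbelianGroup; Ring)
open import Algebra.Structures using (IsAbelianGroup)
import Algebra.Properties.Group as GroupProperties
open import Algebra.Properties.Semiring.Sum (Ring.semiring ℚ.+-*-ring)
  using (sum; sum-cong-≗; sum-replicate-zero; sum-remove; ∑-comm; *-distribʳ-sum)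
open import Algebra.Properties.Semiring.Exp (Ring.semiring ℚ.+-*-ring) using (_^_)
open import Relation.Nullary using (¬_; Dec; yes; no; contradiction)
open import Relation.Nullary.Decidable using (⌊_⌋; toWitness)
open import Relation.Binary.Definitions using (tri<; tri≈; tri>)
open import Relation.Binary.PropositionalEquality
  using (refl; sym; trans; cong; cong₂; subst; subst₂; isEquivalence; module ≡-Reasoning)

1^k≡1 : ∀ k → 1ℚ ^ k ≡ 1ℚ
1^k≡1 zero    = refl
1^k≡1 (suc k) = trans (ℚ.*-identityˡ (1ℚ ^ k)) (1^k≡1 k)

∣q^k∣≡∣q∣^k : ∀ q k → ∣ q ^ k ∣ ≡ ∣ q ∣ ^ k
∣q^k∣≡∣q∣^k q zero    = refl
∣q^k∣≡∣q∣^k q (suc k) = trans (ℚ.∣p*q∣≡∣p∣*∣q∣ q (q ^ k)) (cong (∣ q ∣ *_) (∣q^k∣≡∣q∣^k q k))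

module _ {q : ℚ} (0≤q : 0ℚ ≤ q) where
  open ℚ.≤-Reasoning

  private instance
    q-nonNegative : NonNegative q
    q-nonNegative = nonNegative 0≤q

  q≤1⇒q^k≤1 : q ≤ 1ℚ → ∀ k → q ^ k ≤ 1ℚ
  q≤1⇒q^k≤1 q≤1 zero    = ℚ.≤-refl
  q≤1⇒q^k≤1 q≤1 (suc k) = begin
    q * q ^ k  ≤⟨ ℚ.*-monoˡ-≤-nonNeg q (q≤1⇒q^k≤1 q≤1 k) ⟩
    q * 1ℚ     ≡⟨ ℚ.*-identityʳ q ⟩
    q          ≤⟨ q≤1 ⟩
    1ℚ         ∎

  1≤q⇒1≤q^k : 1ℚ ≤ q → ∀ k → 1ℚ ≤ q ^ k
  1≤q⇒1≤q^k 1≤q zero    = ℚ.≤-refl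
  1≤q⇒1≤q^k 1≤q (suc k) = begin
    1ℚ         ≤⟨ 1≤q ⟩
    q          ≡⟨ ℚ.*-identityʳ q ⟨
    q * 1ℚ     ≤⟨ ℚ.*-monoˡ-≤-nonNeg q (1≤q⇒1≤q^k 1≤q k) ⟩
    q * q ^ k  ∎

  q^[1+k]≡1⇒q≡1 : ∀ k → q ^ suc k ≡ 1ℚ → q ≡ 1ℚ
  q^[1+k]≡1⇒q≡1 k q^[1+k]≡1 with ℚ.<-cmp q 1ℚ
  ... | tri≈ _ q≡1 _ = q≡1
  ... | tri< q<1 _ _ = contradiction (begin-strict
    1ℚ         ≡⟨ q^[1+k]≡1 ⟨
    q * q ^ k  ≤⟨ ℚ.*-monoˡ-≤-nonNeg q (q≤1⇒q^k≤1 (ℚ.<⇒≤ q<1) k) ⟩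
    q * 1ℚ     ≡⟨ ℚ.*-identityʳ q ⟩
    q          <⟨ q<1 ⟩
    1ℚ         ∎) (ℚ.<-irrefl refl)
  ... | tri> _ _ 1<q = contradiction (begin-strict
    1ℚ         <⟨ 1<q ⟩
    q          ≡⟨ ℚ.*-identityʳ q ⟨
    q * 1ℚ     ≤⟨ ℚ.*-monoˡ-≤-nonNeg q (1≤q⇒1≤q^k (ℚ.<⇒≤ 1<q) k) ⟩
    q * q ^ k  ≡⟨ q^[1+k]≡1 ⟩
    1ℚ         ∎) (ℚ.<-irrefl refl)

open ≡-Reasoning

p+q≡0⇒p≡-q : ∀ {p q} → p + q ≡ 0ℚ → p ≡ - q
p+q≡0⇒p≡-q {p} {q} p+q≡0 = begin
  p              ≡⟨ solve 2 (λ p q → p := (p :+ q) :+ (:- q)) refl p q ⟩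
  (p + q) + - q  ≡⟨ cong (_+ - q) p+q≡0 ⟩
  0ℚ + - q       ≡⟨ ℚ.+-identityˡ (- q) ⟩
  - q            ∎
  where open +-*-Solver

p+q≡0⇒∣p∣≡∣q∣ : ∀ p q → p + q ≡ 0ℚ → ∣ p ∣ ≡ ∣ q ∣
p+q≡0⇒∣p∣≡∣q∣ p q p+q≡0 = trans (cong ∣_∣ (p+q≡0⇒p≡-q p+q≡0)) (ℚ.∣-p∣≡∣p∣ q)

*-identityˡ-unique : ∀ {c x} → x ≢ 0ℚ → c * x ≡ x → c ≡ 1ℚ
*-identityˡ-unique {c} {x} x≢0 cx≡x = begin
  c                 ≡⟨ ℚ.*-identityʳ c ⟨
  c * 1ℚ            ≡⟨ cong (c *_) (ℚ.*-inverseʳ x) ⟨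
  c * (x * 1/ x)    ≡⟨ ℚ.*-assoc c x (1/ x) ⟨
  (c * x) * 1/ x    ≡⟨ cong (_* 1/ x) cx≡x ⟩
  x * 1/ x          ≡⟨ ℚ.*-inverseʳ x ⟩
  1ℚ                ∎
  where instance _ = ≢-nonZero x≢0

Σ≡sum : ∀ {m} (f : Fin m → ℚ) → Σ f ≡ sum f
Σ≡sum {zero}  f = refl
Σ≡sum {suc m} f = cong (f zero +_) (Σ≡sum (f ∘ suc))

sum-zero : ∀ {m} {f : Fin m → ℚ} → (∀ i → f i ≡ 0ℚ) → sum f ≡ 0ℚ
sum-zero {m} f≗0 = trans (sum-cong-≗ f≗0) (sum-replicate-zero m)

sum-single : ∀ {m} {f : Fin m → ℚ} t → (∀ i → i ≢ t → f i ≡ 0ℚ) → sum f ≡ f t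
sum-single {suc m} {f} t f≡0 = begin
  sum f                     ≡⟨ sum-remove f ⟩
  f t + sum (removeAt f t)  ≡⟨ cong (f t +_) (sum-zero (λ i → f≡0 _ (punchInᵢ≢i t i))) ⟩
  f t + 0ℚ                  ≡⟨ ℚ.+-identityʳ (f t) ⟩
  f t                       ∎

sum-exchange : ∀ {m} {f g : Fin m → ℚ} t → (∀ i → i ≢ t → f i ≡ g i) → f t + sum g ≡ g t + sum f
sum-exchange {suc m} {f} {g} t f≡g = begin
  f t + sum g                       ≡⟨ cong (f t +_) (sum-remove g) ⟩
  f t + (g t + sum (removeAt g t))  ≡⟨ cong (λ r → f t + (g t + r)) (sum-cong-≗ g≗f-off-t) ⟩
  f t + (g t + rest)                ≡⟨ solve 3 (λ x y z → x :+ (y :+ z) := y :+ (x :+ z)) refl (f t) (g t) rest ⟩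
  g t + (f t + rest)                ≡⟨ cong (g t +_) (sum-remove f) ⟨
  g t + sum f                       ∎
  where
  open +-*-Solver
  rest : ℚ
  rest = sum (removeAt f t)
  g≗f-off-t : ∀ i → removeAt g t i ≡ removeAt f t i
  g≗f-off-t i = sym (f≡g _ (punchInᵢ≢i t i))

sum-++ : ∀ p {q} (f : Fin (p ℕ.+ q) → ℚ) → sum f ≡ sum (f ∘ (_↑ˡ q)) + sum (f ∘ (p ↑ʳ_))
sum-++ zero    f = sym (ℚ.+-identityˡ (sum f))
sum-++ (suc p) f = trans (cong (f zero +_) (sum-++ p (f ∘ suc))) (sym (ℚ.+-assoc (f zero) _ _))

sum-combine : ∀ m {k} (f : Fin (m ℕ.* k) → ℚ) → sum f ≡ sum {m} λ a → sum {k} λ j → f (combine a j)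
sum-combine zero        f = refl
sum-combine (suc m) {k} f = trans (sum-++ k f) (cong (sum (f ∘ (_↑ˡ m ℕ.* k)) +_) (sum-combine m (f ∘ (k ↑ʳ_))))

if-yes : ∀ {A B : Set} (d : Dec A) {p q : B} → A → (if ⌊ d ⌋ then p else q) ≡ p
if-yes (yes _) _ = refl
if-yes (no ¬a) a = contradiction a ¬a

if-no : ∀ {A B : Set} (d : Dec A) {p q : B} → ¬ A → (if ⌊ d ⌋ then p else q) ≡ q
if-no (yes a) ¬a = contradiction a ¬a
if-no (no _)  _  = refl

⌊≟⌋-injective : ∀ {m k} (f : Fin m → Fin k) → (∀ {x y} → f x ≡ f y → x ≡ y) →
                ∀ x y → ⌊ f x Fin.≟ f y ⌋ ≡ ⌊ x Fin.≟ y ⌋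
⌊≟⌋-injective f f-inj x y with x Fin.≟ y | f x Fin.≟ f y
... | yes _   | yes _     = refl
... | no _    | no _      = refl
... | yes x≡y | no fx≢fy  = contradiction (cong f x≡y) fx≢fy
... | no x≢y  | yes fx≡fy = contradiction (f-inj fx≡fy) x≢y

-- The cyclic group ℤₙ

module ℤₙ (n : ℕ) .{{_ : NonZero n}} where

  infixl 6 _⊕_
  _⊕_ : Fin n → Fin n → Fin n
  _⊕_ = _+ₙ_ n

  ⊖_ : Fin n → Fin n
  ⊖_ = -ₙ_ n

  0ₙ 1ₙ : Fin n
  0ₙ = 0 mod n
  1ₙ = 1 mod n

  toℕ-mod : ∀ m → toℕ (m mod n) ≡ m % n
  toℕ-mod m = toℕ-fromℕ< (m%n<n m n)

  %≡⇒mod≡ : ∀ {m k} → m % n ≡ k % n → m mod n ≡ k mod n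
  %≡⇒mod≡ {m} {k} e = toℕ-injective (trans (toℕ-mod m) (trans e (sym (toℕ-mod k))))

  mod-toℕ : ∀ x → toℕ x mod n ≡ x
  mod-toℕ x = toℕ-injective (trans (toℕ-mod (toℕ x)) (m<n⇒m%n≡m (toℕ<n x)))

  mod-homo-+ : ∀ m k → (m mod n) ⊕ (k mod n) ≡ (m ℕ.+ k) mod n
  mod-homo-+ m k = %≡⇒mod≡ (begin
    (toℕ (m mod n) ℕ.+ toℕ (k mod n)) % n  ≡⟨ cong₂ (λ p q → (p ℕ.+ q) % n) (toℕ-mod m) (toℕ-mod k) ⟩
    (m % n ℕ.+ k % n) % n                  ≡⟨ %-distribˡ-+ m k n ⟨
    (m ℕ.+ k) % n                          ∎)

  n-mod : n mod n ≡ 0ₙ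
  n-mod = %≡⇒mod≡ (trans (n%n≡0 n) (sym (m<n⇒m%n≡m (ℕ.>-nonZero⁻¹ n))))

  suc-mod : ∀ k → suc k mod n ≡ (k mod n) ⊕ 1ₙ
  suc-mod k = trans (cong (_mod n) (ℕ.+-comm 1 k)) (sym (mod-homo-+ k 1))

  ⊕-assoc : ∀ x y z → (x ⊕ y) ⊕ z ≡ x ⊕ (y ⊕ z)
  ⊕-assoc x y z = begin
    (x ⊕ y) ⊕ z                          ≡⟨ cong ((x ⊕ y) ⊕_) (mod-toℕ z) ⟨
    (x ⊕ y) ⊕ (toℕ z mod n)              ≡⟨ mod-homo-+ (toℕ x ℕ.+ toℕ y) (toℕ z) ⟩
    (toℕ x ℕ.+ toℕ y ℕ.+ toℕ z) mod n    ≡⟨ cong (_mod n) (ℕ.+-assoc (toℕ x) (toℕ y) (toℕ z)) ⟩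
    (toℕ x ℕ.+ (toℕ y ℕ.+ toℕ z)) mod n  ≡⟨ mod-homo-+ (toℕ x) (toℕ y ℕ.+ toℕ z) ⟨
    (toℕ x mod n) ⊕ (y ⊕ z)              ≡⟨ cong (_⊕ (y ⊕ z)) (mod-toℕ x) ⟩
    x ⊕ (y ⊕ z)                          ∎

  ⊕-comm : ∀ x y → x ⊕ y ≡ y ⊕ x
  ⊕-comm x y = cong (_mod n) (ℕ.+-comm (toℕ x) (toℕ y))

  ⊕-identityˡ : ∀ x → 0ₙ ⊕ x ≡ x
  ⊕-identityˡ x = begin
    0ₙ ⊕ x              ≡⟨ cong (0ₙ ⊕_) (mod-toℕ x) ⟨
    0ₙ ⊕ (toℕ x mod n)  ≡⟨ mod-homo-+ 0 (toℕ x) ⟩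
    toℕ x mod n         ≡⟨ mod-toℕ x ⟩
    x                   ∎

  ⊖-inverseˡ : ∀ x → ⊖ x ⊕ x ≡ 0ₙ
  ⊖-inverseˡ x = begin
    ⊖ x ⊕ x                        ≡⟨ cong (⊖ x ⊕_) (mod-toℕ x) ⟨
    ⊖ x ⊕ (toℕ x mod n)            ≡⟨ mod-homo-+ (n ∸ toℕ x) (toℕ x) ⟩
    ((n ∸ toℕ x) ℕ.+ toℕ x) mod n  ≡⟨ cong (_mod n) (ℕ.m∸n+n≡m (ℕ.<⇒≤ (toℕ<n x))) ⟩
    n mod n                        ≡⟨ n-mod ⟩
    0ₙ                             ∎

  ⊕-isAbelianGroup : IsAbelianGroup _≡_ _⊕_ 0ₙ ⊖_
  ⊕-isAbelianGroup = record
    { isGroup = record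
      { isMonoid = record
        { isSemigroup = record
          { isMagma = record { isEquivalence = isEquivalence ; ∙-cong = cong₂ _⊕_ }
          ; assoc   = ⊕-assoc
          }
        ; identity = ⊕-identityˡ , λ x → trans (⊕-comm x 0ₙ) (⊕-identityˡ x)
        }
      ; inverse = ⊖-inverseˡ , λ x → trans (⊕-comm x (⊖ x)) (⊖-inverseˡ x)
      ; ⁻¹-cong = cong ⊖_
      }
    ; comm = ⊕-comm
    }

  ⊕-abelianGroup : AbelianGroup 0ℓ 0ℓ
  ⊕-abelianGroup = record { isAbelianGroup = ⊕-isAbelianGroup }

  open AbelianGroup ⊕-abelianGroup using (group; commutativeSemigroup)
  open GroupProperties group public using (\\-leftDividesˡ; \\-leftDividesʳ)
  open import Algebra.Properties.Loop (GroupProperties.loop group) public using (identityˡ-unique)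
  open import Algebra.Properties.Quasigroup (GroupProperties.quasigroup group) public using (cancelʳ)
  open import Algebra.Properties.CommutativeSemigroup commutativeSemigroup public using (x∙yz≈y∙xz)

  shift-scaled⇒∣∣-constant : ∀ {f : Fin n → ℚ} {c} → (∀ j → f (j ⊕ 1ₙ) ≡ c * f j) → f 0ₙ ≢ 0ℚ →
                             ∀ j → ∣ f j ∣ ≡ ∣ f 0ₙ ∣
  shift-scaled⇒∣∣-constant {f} {c} f-shift f0≢0 j = begin
    ∣ f j ∣                   ≡⟨ cong (∣_∣ ∘ f) (mod-toℕ j) ⟨
    ∣ f (toℕ j mod n) ∣       ≡⟨ cong ∣_∣ (f-powers (toℕ j)) ⟩
    ∣ c ^ toℕ j * f 0ₙ ∣      ≡⟨ ℚ.∣p*q∣≡∣p∣*∣q∣ (c ^ toℕ j) (f 0ₙ) ⟩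
    ∣ c ^ toℕ j ∣ * ∣ f 0ₙ ∣  ≡⟨ cong (_* ∣ f 0ₙ ∣) (∣q^k∣≡∣q∣^k c (toℕ j)) ⟩
    ∣ c ∣ ^ toℕ j * ∣ f 0ₙ ∣  ≡⟨ cong (λ q → q ^ toℕ j * ∣ f 0ₙ ∣) ∣c∣≡1 ⟩
    1ℚ ^ toℕ j * ∣ f 0ₙ ∣     ≡⟨ cong (_* ∣ f 0ₙ ∣) (1^k≡1 (toℕ j)) ⟩
    1ℚ * ∣ f 0ₙ ∣             ≡⟨ ℚ.*-identityˡ ∣ f 0ₙ ∣ ⟩
    ∣ f 0ₙ ∣                  ∎
    where
    f-powers : ∀ k → f (k mod n) ≡ c ^ k * f 0ₙ
    f-powers zero    = sym (ℚ.*-identityˡ (f 0ₙ))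
    f-powers (suc k) = begin
      f (suc k mod n)     ≡⟨ cong f (suc-mod k) ⟩
      f ((k mod n) ⊕ 1ₙ)  ≡⟨ f-shift (k mod n) ⟩
      c * f (k mod n)     ≡⟨ cong (c *_) (f-powers k) ⟩
      c * (c ^ k * f 0ₙ)  ≡⟨ ℚ.*-assoc c (c ^ k) (f 0ₙ) ⟨
      c ^ suc k * f 0ₙ    ∎
    c^n≡1 : c ^ n ≡ 1ℚ
    c^n≡1 = *-identityˡ-unique f0≢0 (trans (sym (f-powers n)) (cong f n-mod))
    ∣c∣≡1 : ∣ c ∣ ≡ 1ℚ
    ∣c∣≡1 = q^[1+k]≡1⇒q≡1 (ℚ.0≤∣p∣ c) (ℕ.pred n)
              (trans (cong (∣ c ∣ ^_) (ℕ.suc-pred n)) (trans (sym (∣q^k∣≡∣q∣^k c n)) (cong ∣_∣ c^n≡1)))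

  module Half (2∣n : 2 ∣ n) where

    half : Fin n
    half = halfₙ n

    n/2+n/2≡n : n / 2 ℕ.+ n / 2 ≡ n
    n/2+n/2≡n = trans (cong (n / 2 ℕ.+_) (sym (ℕ.+-identityʳ (n / 2)))) (trans (ℕ.*-comm 2 (n / 2)) (m/n*n≡m 2∣n))

    half⊕half⊕ : ∀ j → half ⊕ (half ⊕ j) ≡ j
    half⊕half⊕ j = begin
      half ⊕ (half ⊕ j)  ≡⟨ ⊕-assoc half half j ⟨
      (half ⊕ half) ⊕ j  ≡⟨ cong (_⊕ j) (trans (mod-homo-+ (n / 2) (n / 2)) (cong (_mod n) n/2+n/2≡n)) ⟩
      (n mod n) ⊕ j      ≡⟨ cong (_⊕ j) n-mod ⟩
      0ₙ ⊕ j             ≡⟨ ⊕-identityˡ j ⟩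
      j                  ∎

    half≢0 : half ≢ 0ₙ
    half≢0 half≡0 = ℕ.≢-nonZero⁻¹ n (begin
      n                ≡⟨ n/2+n/2≡n ⟨
      n / 2 ℕ.+ n / 2  ≡⟨ cong (λ m → m ℕ.+ m) n/2≡0 ⟩
      0                ∎)
      where
      n/2≡0 : n / 2 ≡ 0
      n/2≡0 = begin
        n / 2      ≡⟨ m<n⇒m%n≡m (m/n<m n 2 (ℕ.n<1+n 1)) ⟨
        n / 2 % n  ≡⟨ toℕ-mod (n / 2) ⟨
        toℕ half   ≡⟨ cong toℕ half≡0 ⟩
        toℕ 0ₙ     ≡⟨ toℕ-mod 0 ⟩
        0 % n      ≡⟨ m<n⇒m%n≡m (ℕ.>-nonZero⁻¹ n) ⟩
        0          ∎

-- Derived graphs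

end : (G : PreStructure) → Fin (nD G) → Fin (nV G)
end G d = beg G (inv G d)

Spans : (G : PreStructure) → (Fin (nV G) → ℚ) → Set
Spans G u = ∀ x → InKernel G x → ∃ λ (κ : ℚ) → ∀ v → x v ≡ κ * u v

adjacency-row : ∀ G (x : Fin (nV G) → ℚ) u →
                Σ (λ v → adj G u v * x v) ≡ sum (λ d → if ⌊ beg G d Fin.≟ u ⌋ then x (end G d) else 0ℚ)
adjacency-row G x u = begin
  Σ (λ v → adj G u v * x v)               ≡⟨ Σ≡sum (λ v → adj G u v * x v) ⟩
  sum (λ v → adj G u v * x v)             ≡⟨ sum-cong-≗ (λ v → cong (_* x v) (Σ≡sum (λ d → edge d v))) ⟩
  sum (λ v → sum (λ d → edge d v) * x v)  ≡⟨ sum-cong-≗ (λ v → *-distribʳ-sum (x v) (λ d → edge d v)) ⟩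
  sum (λ v → sum (λ d → edge d v * x v))  ≡⟨ ∑-comm (λ v d → edge d v * x v) ⟩
  sum (λ d → sum (λ v → edge d v * x v))  ≡⟨ sum-cong-≗ edges-from ⟩
  sum (λ d → if ⌊ beg G d Fin.≟ u ⌋ then x (end G d) else 0ℚ) ∎
  where
  edge : Fin (nD G) → Fin (nV G) → ℚ
  edge d v = if ⌊ beg G d Fin.≟ u ⌋ ∧ ⌊ end G d Fin.≟ v ⌋ then 1ℚ else 0ℚ
  edges-from : ∀ d → sum (λ v → edge d v * x v) ≡ (if ⌊ beg G d Fin.≟ u ⌋ then x (end G d) else 0ℚ)
  edges-from d with beg G d Fin.≟ u
  ... | no _  = sum-zero (λ v → ℚ.*-zeroˡ (x v))
  ... | yes _ = begin
    sum (λ v → (if ⌊ end G d Fin.≟ v ⌋ then 1ℚ else 0ℚ) * x v)  ≡⟨ sum-single (end G d) off-end ⟩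
    (if ⌊ end G d Fin.≟ end G d ⌋ then 1ℚ else 0ℚ) * x (end G d)
      ≡⟨ cong (_* x (end G d)) (if-yes (end G d Fin.≟ end G d) refl) ⟩
    1ℚ * x (end G d)                                             ≡⟨ ℚ.*-identityˡ (x (end G d)) ⟩
    x (end G d)                                                  ∎
    where
    off-end : ∀ v → v ≢ end G d → (if ⌊ end G d Fin.≟ v ⌋ then 1ℚ else 0ℚ) * x v ≡ 0ℚ
    off-end v v≢end = trans (cong (_* x v) (if-no (end G d Fin.≟ v) (v≢end ∘ sym))) (ℚ.*-zeroˡ (x v))

toOrbits : ∀ {m n} → (Fin (m ℕ.* n) → ℚ) → Fin m → Fin n → ℚ
toOrbits x v j = x (combine v j)

fromOrbits : ∀ {m} n → (Fin m → Fin n → ℚ) → Fin (m ℕ.* n) → ℚ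
fromOrbits n y = uncurry y ∘ remQuot n

toOrbits-fromOrbits : ∀ {m n} (y : Fin m → Fin n → ℚ) v j → toOrbits (fromOrbits n y) v j ≡ y v j
toOrbits-fromOrbits y v j = cong (uncurry y) (remQuot-combine v j)

module Derived (X : PreStructure) (n : ℕ) .{{_ : NonZero n}} (φ : Fin (nD X) → Fin n) where
  open ℤₙ n

  private
    G : PreStructure
    G = derived X n φ

  beg-combine : ∀ p j → beg G (combine p j) ≡ combine (beg X p) j
  beg-combine p j = cong (λ (q , k) → combine (beg X q) k) (remQuot-combine p j)

  end-combine : ∀ p j → end G (combine p j) ≡ combine (end X p) (φ p ⊕ j)
  end-combine p j = trans (cong (beg G) inv-combine) (beg-combine (inv X p) (φ p ⊕ j))
    where
    inv-combine : inv G (combine p j) ≡ combine (inv X p) (φ p ⊕ j)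
    inv-combine = cong (λ (q , k) → combine (inv X q) (φ q ⊕ k)) (remQuot-combine p j)

  neighbourSum : (Fin (nV X) → Fin n → ℚ) → Fin (nV X) → Fin n → ℚ
  neighbourSum y v i = sum λ p → if ⌊ beg X p Fin.≟ v ⌋ then y (end X p) (φ p ⊕ i) else 0ℚ

  InOrbitKernel : (Fin (nV X) → Fin n → ℚ) → Set
  InOrbitKernel y = ∀ v i → neighbourSum y v i ≡ 0ℚ

  neighbourSum-cong : ∀ {y y'} → (∀ v j → y v j ≡ y' v j) → ∀ v i → neighbourSum y v i ≡ neighbourSum y' v i
  neighbourSum-cong y≗y' v i =
    sum-cong-≗ λ p → cong (if ⌊ beg X p Fin.≟ v ⌋ then_else 0ℚ) (y≗y' (end X p) (φ p ⊕ i))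

  adjacency-combine : ∀ x v i → Σ (λ w → adj G (combine v i) w * x w) ≡ neighbourSum (toOrbits x) v i
  adjacency-combine x v i = begin
    Σ (λ w → adj G (combine v i) w * x w)                      ≡⟨ adjacency-row G x (combine v i) ⟩
    sum dartTerm                                               ≡⟨ sum-combine (nD X) {n} dartTerm ⟩
    sum (λ p → sum (λ j → dartTerm (combine {nD X} {n} p j)))  ≡⟨ sum-cong-≗ orbitTerm ⟩
    neighbourSum (toOrbits x) v i                              ∎
    where
    dartTerm : Fin (nD G) → ℚ
    dartTerm d = if ⌊ beg G d Fin.≟ combine v i ⌋ then x (end G d) else 0ℚ
    orbitTerm : ∀ p → sum (λ j → dartTerm (combine {nD X} {n} p j))
                      ≡ (if ⌊ beg X p Fin.≟ v ⌋ then x (combine (end X p) (φ p ⊕ i)) else 0ℚ)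
    orbitTerm p with beg X p Fin.≟ v
    ... | yes refl = trans (sum-single i off-i) (trans (if-yes (_ Fin.≟ _) (beg-combine p i)) (cong x (end-combine p i)))
      where
      off-i : ∀ j → j ≢ i → dartTerm (combine p j) ≡ 0ℚ
      off-i j j≢i = if-no (_ Fin.≟ _) (j≢i ∘ combine-injectiveʳ (beg X p) j (beg X p) i ∘ trans (sym (beg-combine p j)))
    ... | no beg≢v = sum-zero λ j →
      if-no (_ Fin.≟ _) (beg≢v ∘ combine-injectiveˡ (beg X p) j v i ∘ trans (sym (beg-combine p j)))

  inKernel⇒inOrbitKernel : ∀ {x} → InKernel G x → InOrbitKernel (toOrbits x)
  inKernel⇒inOrbitKernel {x} x∈ker v i = trans (sym (adjacency-combine x v i)) (x∈ker (combine v i))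

  inOrbitKernel⇒inKernel : ∀ {y} → InOrbitKernel y → InKernel G (fromOrbits n y)
  inOrbitKernel⇒inKernel {y} y∈ker w with combine-surjective {nV X} {n} w
  ... | v , i , refl = begin
    Σ (λ w → adj G (combine v i) w * fromOrbits n y w)  ≡⟨ adjacency-combine (fromOrbits n y) v i ⟩
    neighbourSum (toOrbits (fromOrbits n y)) v i        ≡⟨ neighbourSum-cong (toOrbits-fromOrbits y) v i ⟩
    neighbourSum y v i                                  ≡⟨ y∈ker v i ⟩
    0ℚ                                                  ∎

  inOrbitKernel-shift : ∀ s {y} → InOrbitKernel y → InOrbitKernel (λ v j → y v (j ⊕ s))
  inOrbitKernel-shift s {y} y∈ker v i = trans (sum-cong-≗ λ p → cong (term p) (⊕-assoc (φ p) i s)) (y∈ker v (i ⊕ s))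
    where
    term : Fin (nD X) → Fin n → ℚ
    term p j = if ⌊ beg X p Fin.≟ v ⌋ then y (end X p) j else 0ℚ

  SimpleLift : Set
  SimpleLift = (∀ p → beg X p ≡ end X p → φ p ≢ 0ₙ)
             × (∀ p q → beg X p ≡ beg X q → end X p ≡ end X q → φ p ≡ φ q → p ≡ q)

  simple⇒simpleLift : Simple G → SimpleLift
  simple⇒simpleLift (_ , no-loop , no-parallel) = no-null-loop , no-parallel-lift
    where
    no-null-loop : ∀ p → beg X p ≡ end X p → φ p ≢ 0ₙ
    no-null-loop p beg≡end φp≡0 = no-loop (combine p 0ₙ) (begin
      beg G (combine p 0ₙ)          ≡⟨ beg-combine p 0ₙ ⟩
      combine (beg X p) 0ₙ          ≡⟨ cong₂ combine beg≡end (trans (sym (⊕-identityˡ 0ₙ)) (cong (_⊕ 0ₙ) (sym φp≡0))) ⟩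
      combine (end X p) (φ p ⊕ 0ₙ)  ≡⟨ end-combine p 0ₙ ⟨
      end G (combine p 0ₙ)          ∎)
    no-parallel-lift : ∀ p q → beg X p ≡ beg X q → end X p ≡ end X q → φ p ≡ φ q → p ≡ q
    no-parallel-lift p q begs ends φs = combine-injectiveˡ p 0ₙ q 0ₙ (no-parallel (combine p 0ₙ) (combine q 0ₙ)
      (trans (beg-combine p 0ₙ) (trans (cong (λ v → combine v 0ₙ) begs) (sym (beg-combine q 0ₙ))))
      (trans (end-combine p 0ₙ) (trans (cong₂ combine ends (cong (_⊕ 0ₙ) φs)) (sym (end-combine q 0ₙ)))))

  simpleLift⇒simple : SimpleLift → Simple G
  simpleLift⇒simple (no-null-loop , no-parallel-lift) = no-semiEdge , no-loop , no-parallel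
    where
    no-loop : ∀ d → beg G d ≢ end G d
    no-loop d beg≡end with combine-surjective {nD X} {n} d
    ... | p , j , refl
      with combine-injective (beg X p) j (end X p) (φ p ⊕ j) (trans (sym (beg-combine p j)) (trans beg≡end (end-combine p j)))
    ... | begX≡endX , j≡φp⊕j = no-null-loop p begX≡endX (identityˡ-unique (φ p) j (sym j≡φp⊕j))

    no-semiEdge : ∀ d → inv G d ≢ d
    no-semiEdge d inv≡d = no-loop d (cong (beg G) (sym inv≡d))

    no-parallel : ∀ d d' → beg G d ≡ beg G d' → end G d ≡ end G d' → d ≡ d'
    no-parallel d d' begs ends with combine-surjective {nD X} {n} d | combine-surjective {nD X} {n} d'
    ... | p , j , refl | q , k , refl
      with combine-injective (beg X p) j (beg X q) k (trans (sym (beg-combine p j)) (trans begs (beg-combine q k)))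
         | combine-injective (end X p) (φ p ⊕ j) (end X q) (φ q ⊕ k)
             (trans (sym (end-combine p j)) (trans ends (end-combine q k)))
    ... | begsX , refl | endsX , φp⊕j≡φq⊕j =
      cong (λ r → combine r j) (no-parallel-lift p q begsX endsX (cancelʳ j (φ p) (φ q) φp⊕j≡φq⊕j))

  module NutVector
    {u : Fin (nV X ℕ.* n) → ℚ} (u≢0 : ∀ w → u w ≢ 0ℚ) (u∈ker : InKernel G u) (u-spans : Spans G u) where

    ∣orbit∣-constant : ∀ v j → ∣ u (combine v j) ∣ ≡ ∣ u (combine v 0ₙ) ∣
    ∣orbit∣-constant v = shift-scaled⇒∣∣-constant {c = proj₁ shift-factor} shift-step (u≢0 (combine v 0ₙ))
      where
      shifted : Fin (nV X) → Fin n → ℚ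
      shifted w j = u (combine w (j ⊕ 1ₙ))
      shift-factor : ∃ λ κ → ∀ w → fromOrbits n shifted w ≡ κ * u w
      shift-factor = u-spans (fromOrbits n shifted)
        (inOrbitKernel⇒inKernel {shifted} (inOrbitKernel-shift 1ₙ {toOrbits u} (inKernel⇒inOrbitKernel {u} u∈ker)))
      shift-step : ∀ j → u (combine v (j ⊕ 1ₙ)) ≡ proj₁ shift-factor * u (combine v j)
      shift-step j = trans (sym (toOrbits-fromOrbits shifted v j)) (proj₂ shift-factor (combine v j))

    differentMagnitudes⇒∣orbit∣≢ : ∀ {a b} → DifferentMagnitudes X n φ a b →
                                   ∀ j k → ∣ u (combine a j) ∣ ≢ ∣ u (combine b k) ∣
    differentMagnitudes⇒∣orbit∣≢ {a} {b} (u' , u'∈ker , _ , j₀ , ∣u'a∣≢∣u'b∣) j k ∣uaj∣≡∣ubk∣ =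
      ∣u'a∣≢∣u'b∣ (begin
      ∣ u' (combine a j₀) ∣         ≡⟨ ∣u'∣ a j₀ ⟩
      ∣ κ ∣ * ∣ u (combine a j₀) ∣  ≡⟨ cong (∣ κ ∣ *_) ∣uaj₀∣≡∣ubj₀∣ ⟩
      ∣ κ ∣ * ∣ u (combine b j₀) ∣  ≡⟨ ∣u'∣ b j₀ ⟨
      ∣ u' (combine b j₀) ∣         ∎)
      where
      κ : ℚ
      κ = proj₁ (u-spans u' u'∈ker)
      ∣u'∣ : ∀ (v : Fin (nV X)) j → ∣ u' (combine v j) ∣ ≡ ∣ κ ∣ * ∣ u (combine v j) ∣
      ∣u'∣ v j = trans (cong ∣_∣ (proj₂ (u-spans u' u'∈ker) (combine v j))) (ℚ.∣p*q∣≡∣p∣*∣q∣ κ _)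
      ∣uaj₀∣≡∣ubj₀∣ : ∣ u (combine a j₀) ∣ ≡ ∣ u (combine b j₀) ∣
      ∣uaj₀∣≡∣ubj₀∣ = begin
        ∣ u (combine a j₀) ∣  ≡⟨ ∣orbit∣-constant a j₀ ⟩
        ∣ u (combine a 0ₙ) ∣  ≡⟨ ∣orbit∣-constant a j ⟨
        ∣ u (combine a j) ∣   ≡⟨ ∣uaj∣≡∣ubk∣ ⟩
        ∣ u (combine b k) ∣   ≡⟨ ∣orbit∣-constant b k ⟩
        ∣ u (combine b 0ₙ) ∣  ≡⟨ ∣orbit∣-constant b j₀ ⟨
        ∣ u (combine b j₀) ∣  ∎

-- The gadget

module Gadget (n : ℕ) .{{_ : NonZero n}} (2∣n : 2 ∣ n) (γ : Fin n) where
  open ℤₙ n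
  open Half 2∣n

  -- The null-vector equations of the replaced graph at the orbits of c, d and e, for the
  -- restrictions yc, yd, ye, ya, yb of a vector to the orbits of c, d, e, a, b.
  record Equations (yc yd ye ya yb : Fin n → ℚ) : Set where
    field
      at-c : ∀ i → yd (half ⊕ i) + (yc (half ⊕ i) + ya (⊖ γ ⊕ i)) ≡ 0ℚ
      at-d : ∀ i → yc (half ⊕ i) + (ye (⊖ γ ⊕ i) + yd (half ⊕ i)) ≡ 0ℚ
      at-e : ∀ i → yd (γ ⊕ i) + (yb (γ ⊕ i) + ye (half ⊕ i)) ≡ 0ℚ

  forced-d : (ya yb : Fin n → ℚ) → Fin n → ℚ
  forced-d ya yb j = - (yb j + ya (⊖ γ ⊕ (half ⊕ j)))

  record Solution (yc yd ye ya yb : Fin n → ℚ) : Set where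
    field
      c≗b      : ∀ j → yc j ≡ yb j
      d≗forced : ∀ j → yd j ≡ forced-d ya yb j
      e≗a      : ∀ j → ye j ≡ ya j

  private
    open +-*-Solver

    -[p+q]+[p+q]≡0 : ∀ p q → - (p + q) + (p + q) ≡ 0ℚ
    -[p+q]+[p+q]≡0 = solve 2 (λ p q → :- (p :+ q) :+ (p :+ q) := con 0ℚ) refl

    p+[q+-[p+q]]≡0 : ∀ p q → p + (q + - (p + q)) ≡ 0ℚ
    p+[q+-[p+q]]≡0 = solve 2 (λ p q → p :+ (q :+ :- (p :+ q)) := con 0ℚ) refl

    p+[q+r]≡0⇒p+[q'+r]≡0⇒q≡q' : ∀ p q q' r → p + (q + r) ≡ 0ℚ → p + (q' + r) ≡ 0ℚ → q ≡ q'
    p+[q+r]≡0⇒p+[q'+r]≡0⇒q≡q' p q q' r e e' = begin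
      q                                        ≡⟨ solve 4 (λ p q q' r → q := p :+ (q :+ r) :+ (:- (p :+ (q' :+ r)) :+ q'))
                                                         refl p q q' r ⟩
      (p + (q + r)) + (- (p + (q' + r)) + q')  ≡⟨ cong₂ (λ s t → s + (- t + q')) e e' ⟩
      0ℚ + (- 0ℚ + q')                         ≡⟨ solve 1 (λ q' → con 0ℚ :+ (:- con 0ℚ :+ q') := q') refl q' ⟩
      q'                                       ∎

    p+[q+r]≡0⇒q+[r'+p]≡0⇒r≡r' : ∀ p q r r' → p + (q + r) ≡ 0ℚ → q + (r' + p) ≡ 0ℚ → r ≡ r'
    p+[q+r]≡0⇒q+[r'+p]≡0⇒r≡r' p q r r' e e' = begin
      r                                        ≡⟨ solve 4 (λ p q r r' → r := p :+ (q :+ r) :+ (:- (q :+ (r' :+ p)) :+ r'))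
                                                         refl p q r r' ⟩
      (p + (q + r)) + (- (q + (r' + p)) + r')  ≡⟨ cong₂ (λ s t → s + (- t + r')) e e' ⟩
      0ℚ + (- 0ℚ + r')                         ≡⟨ solve 1 (λ r' → con 0ℚ :+ (:- con 0ℚ :+ r') := r') refl r' ⟩
      r'                                       ∎

  forced-solution : ∀ ya yb → Equations yb (forced-d ya yb) ya ya yb
  forced-solution ya yb = record { at-c = at-c ; at-d = at-d ; at-e = at-e }
    where
    forced-d-half : ∀ i → forced-d ya yb (half ⊕ i) ≡ - (yb (half ⊕ i) + ya (⊖ γ ⊕ i))
    forced-d-half i = cong (λ j → - (yb (half ⊕ i) + ya (⊖ γ ⊕ j))) (half⊕half⊕ i)

    at-c : ∀ i → forced-d ya yb (half ⊕ i) + (yb (half ⊕ i) + ya (⊖ γ ⊕ i)) ≡ 0ℚ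
    at-c i = trans (cong (_+ (yb (half ⊕ i) + ya (⊖ γ ⊕ i))) (forced-d-half i))
                   (-[p+q]+[p+q]≡0 (yb (half ⊕ i)) (ya (⊖ γ ⊕ i)))

    at-d : ∀ i → yb (half ⊕ i) + (ya (⊖ γ ⊕ i) + forced-d ya yb (half ⊕ i)) ≡ 0ℚ
    at-d i = trans (cong (λ r → yb (half ⊕ i) + (ya (⊖ γ ⊕ i) + r)) (forced-d-half i))
                   (p+[q+-[p+q]]≡0 (yb (half ⊕ i)) (ya (⊖ γ ⊕ i)))

    at-e : ∀ i → forced-d ya yb (γ ⊕ i) + (yb (γ ⊕ i) + ya (half ⊕ i)) ≡ 0ℚ
    at-e i = trans (cong (λ j → - (yb (γ ⊕ i) + ya j) + (yb (γ ⊕ i) + ya (half ⊕ i))) ⊖γ⊕half⊕γ⊕i≡half⊕i)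
                   (-[p+q]+[p+q]≡0 (yb (γ ⊕ i)) (ya (half ⊕ i)))
      where
      ⊖γ⊕half⊕γ⊕i≡half⊕i : ⊖ γ ⊕ (half ⊕ (γ ⊕ i)) ≡ half ⊕ i
      ⊖γ⊕half⊕γ⊕i≡half⊕i = trans (cong (⊖ γ ⊕_) (x∙yz≈y∙xz half γ i)) (\\-leftDividesʳ γ (half ⊕ i))

  equations⇒solution : ∀ {yc yd ye ya yb} → Equations yc yd ye ya yb → Solution yc yd ye ya yb
  equations⇒solution {yc} {yd} {ye} {ya} {yb} eqs = record { c≗b = c≗b ; d≗forced = d≗forced ; e≗a = e≗a }
    where
    open Equations eqs

    e≗a : ∀ j → ye j ≡ ya j
    e≗a j = sym (subst (λ k → ya k ≡ ye k) (\\-leftDividesʳ γ j)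
      (p+[q+r]≡0⇒q+[r'+p]≡0⇒r≡r' (yd (half ⊕ (γ ⊕ j))) (yc (half ⊕ (γ ⊕ j))) _ _
        (at-c (γ ⊕ j)) (at-d (γ ⊕ j))))

    at-c′ : ∀ j → yd j + (yc j + ya (⊖ γ ⊕ (half ⊕ j))) ≡ 0ℚ
    at-c′ j = subst (λ k → yd k + (yc k + ya (⊖ γ ⊕ (half ⊕ j))) ≡ 0ℚ) (half⊕half⊕ j) (at-c (half ⊕ j))

    at-e′ : ∀ j → yd j + (yb j + ya (⊖ γ ⊕ (half ⊕ j))) ≡ 0ℚ
    at-e′ j = subst₂ (λ k l → yd k + (yb k + ya l) ≡ 0ℚ) (\\-leftDividesˡ γ j) (x∙yz≈y∙xz half (⊖ γ) j)
      (trans (cong (λ r → yd (γ ⊕ (⊖ γ ⊕ j)) + (yb (γ ⊕ (⊖ γ ⊕ j)) + r)) (sym (e≗a (half ⊕ (⊖ γ ⊕ j)))))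
             (at-e (⊖ γ ⊕ j)))

    c≗b : ∀ j → yc j ≡ yb j
    c≗b j = p+[q+r]≡0⇒p+[q'+r]≡0⇒q≡q' (yd j) (yc j) (yb j) (ya (⊖ γ ⊕ (half ⊕ j))) (at-c′ j) (at-e′ j)

    d≗forced : ∀ j → yd j ≡ forced-d ya yb j
    d≗forced j = trans (p+q≡0⇒p≡-q (at-c′ j)) (cong (λ q → - (q + ya (⊖ γ ⊕ (half ⊕ j)))) (c≗b j))

-- The replaced voltage pregraph

module EdgeReplacement
  (n : ℕ) .{{_ : NonZero n}} (2∣n : 2 ∣ n)
  (X : PreStructure) (X-pregraph : IsPregraph X)
  (φ : Fin (nD X) → Fin n) (φ-voltage : IsVoltage X n φ)
  (a b : Fin (nV X)) (a≢b : a ≢ b)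
  (δ : Fin (nD X)) (beg-δ : beg X δ ≡ a) (end-δ : beg X (inv X δ) ≡ b) where

  open ℤₙ n
  open Half 2∣n
  open Construction X n φ δ b using (γ; vc; vd; ve; old; newBeg; newInv; newφ)
  open Gadget n 2∣n γ

  X′ : PreStructure
  X′ = X₁ X n φ δ b

  φ′ : Fin (nD X′) → Fin n
  φ′ = φ₁ X n φ δ b

  module D  = Derived X n φ
  module D′ = Derived X′ n φ′

  δ⁻ : Fin (nD X)
  δ⁻ = inv X δ

  inv-inv : ∀ x → inv X (inv X x) ≡ x
  inv-inv = proj₂ X-pregraph

  δ≢δ⁻ : δ ≢ δ⁻
  δ≢δ⁻ δ≡δ⁻ = a≢b (trans (sym beg-δ) (trans (cong (beg X) δ≡δ⁻) end-δ))

  end-δ⁻ : end X δ⁻ ≡ a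
  end-δ⁻ = trans (cong (beg X) (inv-inv δ)) beg-δ

  -- For an old dart x, beg X′ (9 ↑ʳ x) and φ′ (9 ↑ʳ x) reduce to oldBeg x and φ x.
  oldBeg : Fin (nD X) → Fin (3 ℕ.+ nV X)
  oldBeg x = if ⌊ x Fin.≟ δ⁻ ⌋ then vc else old (beg X x)

  oldBeg-≢δ⁻ : ∀ {x} → x ≢ δ⁻ → oldBeg x ≡ old (beg X x)
  oldBeg-≢δ⁻ {x} = if-no (x Fin.≟ δ⁻)

  oldBeg-δ⁻ : oldBeg δ⁻ ≡ vc
  oldBeg-δ⁻ = if-yes (δ⁻ Fin.≟ δ⁻) refl

  oldBeg-δ : oldBeg δ ≡ old a
  oldBeg-δ = trans (oldBeg-≢δ⁻ δ≢δ⁻) (cong old beg-δ)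

  oldBeg≡vc⇒≡δ⁻ : ∀ x → oldBeg x ≡ vc → x ≡ δ⁻
  oldBeg≡vc⇒≡δ⁻ x with x Fin.≟ δ⁻
  ... | yes x≡δ⁻ = λ _ → x≡δ⁻
  ... | no _     = λ ()

  oldBeg≢vd : ∀ x → oldBeg x ≢ vd
  oldBeg≢vd x with x Fin.≟ δ⁻
  ... | yes _ = λ ()
  ... | no _  = λ ()

  oldBeg≢ve : ∀ x → oldBeg x ≢ ve
  oldBeg≢ve x with x Fin.≟ δ⁻
  ... | yes _ = λ ()
  ... | no _  = λ ()

  oldSum : (Fin (3 ℕ.+ nV X) → Fin n → ℚ) → Fin (3 ℕ.+ nV X) → Fin n → ℚ
  oldSum y w i = sum λ x → if ⌊ oldBeg x Fin.≟ w ⌋ then y (oldBeg (inv X x)) (φ x ⊕ i) else 0ℚ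

  oldSum-vc : ∀ y i → oldSum y vc i ≡ y (old a) (⊖ γ ⊕ i)
  oldSum-vc y i = begin
    oldSum y vc i                      ≡⟨ sum-single δ⁻ off-δ⁻ ⟩
    (if ⌊ oldBeg δ⁻ Fin.≟ vc ⌋ then y (oldBeg (inv X δ⁻)) (φ δ⁻ ⊕ i) else 0ℚ)
                                       ≡⟨ if-yes (oldBeg δ⁻ Fin.≟ vc) oldBeg-δ⁻ ⟩
    y (oldBeg (inv X δ⁻)) (φ δ⁻ ⊕ i)   ≡⟨ cong₂ (λ w k → y w (k ⊕ i)) (trans (cong oldBeg (inv-inv δ)) oldBeg-δ)
                                                                     (φ-voltage δ) ⟩
    y (old a) (⊖ γ ⊕ i)                ∎
    where
    off-δ⁻ : ∀ x → x ≢ δ⁻ → (if ⌊ oldBeg x Fin.≟ vc ⌋ then y (oldBeg (inv X x)) (φ x ⊕ i) else 0ℚ) ≡ 0ℚ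
    off-δ⁻ x x≢δ⁻ = if-no (oldBeg x Fin.≟ vc) (x≢δ⁻ ∘ oldBeg≡vc⇒≡δ⁻ x)

  oldSum-vd : ∀ y i → oldSum y vd i ≡ 0ℚ
  oldSum-vd y i = sum-zero λ x → if-no (oldBeg x Fin.≟ vd) (oldBeg≢vd x)

  oldSum-ve : ∀ y i → oldSum y ve i ≡ 0ℚ
  oldSum-ve y i = sum-zero λ x → if-no (oldBeg x Fin.≟ ve) (oldBeg≢ve x)

  private
    open +-*-Solver
    𝟘 : ∀ {k} → Polynomial k
    𝟘 = con 0ℚ

  -- Each solver call lists the terms of the nine new darts in order, followed by the sum over the old darts.
  neighbourSum-vc : ∀ y i → D′.neighbourSum y vc i ≡ y vd (half ⊕ i) + (y vc (half ⊕ i) + y (old a) (⊖ γ ⊕ i))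
  neighbourSum-vc y i = trans
    (solve 3 (λ A B R → 𝟘 :+ (A :+ (𝟘 :+ (𝟘 :+ (𝟘 :+ (𝟘 :+ (B :+ (𝟘 :+ (𝟘 :+ R)))))))) := A :+ (B :+ R))
       refl (y vd (half ⊕ i)) (y vc (half ⊕ i)) (oldSum y vc i))
    (cong (λ r → y vd (half ⊕ i) + (y vc (half ⊕ i) + r)) (oldSum-vc y i))

  neighbourSum-vd : ∀ y i → D′.neighbourSum y vd i ≡ y vc (half ⊕ i) + (y ve (⊖ γ ⊕ i) + y vd (half ⊕ i))
  neighbourSum-vd y i = trans
    (solve 4 (λ A B C R → A :+ (𝟘 :+ (𝟘 :+ (B :+ (𝟘 :+ (𝟘 :+ (𝟘 :+ (C :+ (𝟘 :+ R)))))))) := A :+ (B :+ C) :+ R)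
       refl (y vc (half ⊕ i)) (y ve (⊖ γ ⊕ i)) (y vd (half ⊕ i)) (oldSum y vd i))
    (trans (cong (y vc (half ⊕ i) + (y ve (⊖ γ ⊕ i) + y vd (half ⊕ i)) +_) (oldSum-vd y i)) (ℚ.+-identityʳ _))

  neighbourSum-ve : ∀ y i → D′.neighbourSum y ve i ≡ y vd (γ ⊕ i) + (y (old b) (γ ⊕ i) + y ve (half ⊕ i))
  neighbourSum-ve y i = trans
    (solve 4 (λ A B C R → 𝟘 :+ (𝟘 :+ (A :+ (𝟘 :+ (B :+ (𝟘 :+ (𝟘 :+ (𝟘 :+ (C :+ R)))))))) := A :+ (B :+ C) :+ R)
       refl (y vd (γ ⊕ i)) (y (old b) (γ ⊕ i)) (y ve (half ⊕ i)) (oldSum y ve i))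
    (trans (cong (y vd (γ ⊕ i) + (y (old b) (γ ⊕ i) + y ve (half ⊕ i)) +_) (oldSum-ve y i)) (ℚ.+-identityʳ _))

  module _ (y : Fin (3 ℕ.+ nV X) → Fin n → ℚ)
           (c≗b : ∀ j → y vc j ≡ y (old b) j) (e≗a : ∀ j → y ve j ≡ y (old a) j) where

    y-oldBeg-inv : ∀ x k → y (oldBeg (inv X x)) k ≡ y (old (end X x)) k
    y-oldBeg-inv x k with inv X x Fin.≟ δ⁻
    ... | yes inv-x≡δ⁻ = trans (c≗b k) (cong (λ w → y (old w) k) (sym (trans (cong (beg X) inv-x≡δ⁻) end-δ)))
    ... | no _         = refl

    -- The new dart b → e takes over the role of δ⁻, which now starts at c.
    neighbourSum-old : ∀ v i → D′.neighbourSum y (old v) i ≡ D.neighbourSum (λ w → y (old w)) v i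
    neighbourSum-old v i = begin
      D′.neighbourSum y (old v) i
        ≡⟨ solve 2 (λ A R → 𝟘 :+ (𝟘 :+ (𝟘 :+ (𝟘 :+ (𝟘 :+ (A :+ (𝟘 :+ (𝟘 :+ (𝟘 :+ R)))))))) := A :+ R)
             refl b→e (oldSum y (old v) i) ⟩
      b→e + sum T′                 ≡⟨ cong (_+ sum T′) b→e≡Tδ⁻ ⟩
      T δ⁻ + sum T′                ≡⟨ sum-exchange δ⁻ T′≡T ⟨
      T′ δ⁻ + sum T                ≡⟨ cong (_+ sum T) T′δ⁻≡0 ⟩
      0ℚ + sum T                   ≡⟨ ℚ.+-identityˡ (sum T) ⟩
      D.neighbourSum (λ w → y (old w)) v i ∎
      where
      b→e : ℚ
      b→e = if ⌊ old b Fin.≟ old v ⌋ then y ve (⊖ γ ⊕ i) else 0ℚ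
      T′ T : Fin (nD X) → ℚ
      T′ x = if ⌊ oldBeg x Fin.≟ old v ⌋ then y (oldBeg (inv X x)) (φ x ⊕ i) else 0ℚ
      T  x = if ⌊ beg X x Fin.≟ v ⌋ then y (old (end X x)) (φ x ⊕ i) else 0ℚ
      ⌊old≟old⌋ : ∀ w → ⌊ old w Fin.≟ old v ⌋ ≡ ⌊ w Fin.≟ v ⌋
      ⌊old≟old⌋ w = ⌊≟⌋-injective old (↑ʳ-injective 3 _ _) w v
      T′≡T : ∀ x → x ≢ δ⁻ → T′ x ≡ T x
      T′≡T x x≢δ⁻ = cong₂ (if_then_else 0ℚ)
        (trans (cong (λ w → ⌊ w Fin.≟ old v ⌋) (oldBeg-≢δ⁻ x≢δ⁻)) (⌊old≟old⌋ (beg X x)))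
        (y-oldBeg-inv x (φ x ⊕ i))
      T′δ⁻≡0 : T′ δ⁻ ≡ 0ℚ
      T′δ⁻≡0 = cong (λ w → if ⌊ w Fin.≟ old v ⌋ then y (oldBeg (inv X δ⁻)) (φ δ⁻ ⊕ i) else 0ℚ) oldBeg-δ⁻
      b→e≡Tδ⁻ : b→e ≡ T δ⁻
      b→e≡Tδ⁻ = cong₂ (if_then_else 0ℚ)
        (trans (⌊old≟old⌋ b) (cong (λ w → ⌊ w Fin.≟ v ⌋) (sym end-δ)))
        (trans (e≗a (⊖ γ ⊕ i)) (sym (cong₂ (λ w k → y (old w) (k ⊕ i)) end-δ⁻ (φ-voltage δ))))

  extend : (Fin (nV X) → Fin n → ℚ) → Fin (3 ℕ.+ nV X) → Fin n → ℚ
  extend y zero                = y b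
  extend y (suc zero)          = forced-d (y a) (y b)
  extend y (suc (suc zero))    = y a
  extend y (suc (suc (suc v))) = y v

  extend-inOrbitKernel : ∀ {y} → D.InOrbitKernel y → D′.InOrbitKernel (extend y)
  extend-inOrbitKernel {y} y∈ker zero                i = trans (neighbourSum-vc (extend y) i) (at-c i)
    where open Equations (forced-solution (y a) (y b))
  extend-inOrbitKernel {y} y∈ker (suc zero)          i = trans (neighbourSum-vd (extend y) i) (at-d i)
    where open Equations (forced-solution (y a) (y b))
  extend-inOrbitKernel {y} y∈ker (suc (suc zero))    i = trans (neighbourSum-ve (extend y) i) (at-e i)
    where open Equations (forced-solution (y a) (y b))
  extend-inOrbitKernel {y} y∈ker (suc (suc (suc v))) i =
    trans (neighbourSum-old (extend y) (λ _ → refl) (λ _ → refl) v i) (y∈ker v i)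

  inOrbitKernel⇒solution : ∀ {y} → D′.InOrbitKernel y → Solution (y vc) (y vd) (y ve) (y (old a)) (y (old b))
  inOrbitKernel⇒solution {y} y∈ker = equations⇒solution record
    { at-c = λ i → trans (sym (neighbourSum-vc y i)) (y∈ker vc i)
    ; at-d = λ i → trans (sym (neighbourSum-vd y i)) (y∈ker vd i)
    ; at-e = λ i → trans (sym (neighbourSum-ve y i)) (y∈ker ve i)
    }

  module ExtendedNutVector
    {u : Fin (nV X ℕ.* n) → ℚ} (u≢0 : ∀ w → u w ≢ 0ℚ)
    (u∈ker : InKernel (derived X n φ) u) (u-spans : Spans (derived X n φ) u)
    (∣ua∣≢∣ub∣ : ∀ j k → ∣ u (combine a j) ∣ ≢ ∣ u (combine b k) ∣) where

    U : Fin (nV X) → Fin n → ℚ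
    U = toOrbits u

    u′ : Fin (nV X′ ℕ.* n) → ℚ
    u′ = fromOrbits n (extend U)

    u′∈ker : InKernel (derived X′ n φ′) u′
    u′∈ker = D′.inOrbitKernel⇒inKernel {extend U} (extend-inOrbitKernel {U} (D.inKernel⇒inOrbitKernel {u} u∈ker))

    extend-U≢0 : ∀ w j → extend U w j ≢ 0ℚ
    extend-U≢0 zero                j = u≢0 (combine b j)
    extend-U≢0 (suc zero)          j = λ forced≡0 →
      ∣ua∣≢∣ub∣ j′ j (sym (p+q≡0⇒∣p∣≡∣q∣ (U b j) (U a j′) (ℚ.neg-injective forced≡0)))
      where
      j′ : Fin n
      j′ = ⊖ γ ⊕ (half ⊕ j)
    extend-U≢0 (suc (suc zero))    j = u≢0 (combine a j)
    extend-U≢0 (suc (suc (suc v))) j = u≢0 (combine v j)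

    u′≢0 : ∀ w → u′ w ≢ 0ℚ
    u′≢0 w = extend-U≢0 (proj₁ (remQuot n w)) (proj₂ (remQuot n w))

    u′-spans : Spans (derived X′ n φ′) u′
    u′-spans x x∈ker = κ , x≡κu′
      where
      y : Fin (3 ℕ.+ nV X) → Fin n → ℚ
      y = toOrbits x
      y∈ker : D′.InOrbitKernel y
      y∈ker = D′.inKernel⇒inOrbitKernel {x} x∈ker
      open Solution (inOrbitKernel⇒solution {y} y∈ker)
      yold : Fin (nV X) → Fin n → ℚ
      yold v = y (old v)
      yold∈ker : D.InOrbitKernel yold
      yold∈ker v i = trans (sym (neighbourSum-old y c≗b e≗a v i)) (y∈ker (old v) i)
      yold-spanned : ∃ λ κ → ∀ w → fromOrbits n yold w ≡ κ * u w
      yold-spanned = u-spans (fromOrbits n yold) (D.inOrbitKernel⇒inKernel {yold} yold∈ker)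
      κ : ℚ
      κ = proj₁ yold-spanned
      yold≡κU : ∀ v j → yold v j ≡ κ * U v j
      yold≡κU v j = trans (sym (toOrbits-fromOrbits yold v j)) (proj₂ yold-spanned (combine v j))
      y≡κ·extend : ∀ w j → y w j ≡ κ * extend U w j
      y≡κ·extend zero                j = trans (c≗b j) (yold≡κU b j)
      y≡κ·extend (suc zero)          j = begin
        y vd j                      ≡⟨ d≗forced j ⟩
        - (yold b j + yold a j′)    ≡⟨ cong₂ (λ p q → - (p + q)) (yold≡κU b j) (yold≡κU a j′) ⟩
        - (κ * U b j + κ * U a j′)  ≡⟨ solve 3 (λ κ p q → :- (κ :* p :+ κ :* q) := κ :* (:- (p :+ q)))
                                                refl κ (U b j) (U a j′) ⟩
        κ * - (U b j + U a j′)      ∎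
        where
        j′ : Fin n
        j′ = ⊖ γ ⊕ (half ⊕ j)
      y≡κ·extend (suc (suc zero))    j = trans (e≗a j) (yold≡κU a j)
      y≡κ·extend (suc (suc (suc v))) j = yold≡κU v j
      x≡κu′ : ∀ w → x w ≡ κ * u′ w
      x≡κu′ w = trans (cong x (sym (combine-remQuot {3 ℕ.+ nV X} n w)))
                      (y≡κ·extend (proj₁ (remQuot n w)) (proj₂ (remQuot n w)))

  -- Undoes the move of δ⁻ from b to c; no old dart ends at d or e, so their images are arbitrary.
  forget : Fin (3 ℕ.+ nV X) → Fin (nV X)
  forget (suc (suc (suc v))) = v
  forget _                   = b

  forget-oldBeg : ∀ x → forget (oldBeg x) ≡ beg X x
  forget-oldBeg x with x Fin.≟ δ⁻
  ... | yes refl = sym end-δ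
  ... | no _     = refl

  data Dart′ : Fin (nD X′) → Set where
    newDart : ∀ i → Dart′ (i ↑ˡ nD X)
    oldDart : ∀ x → Dart′ (9 ↑ʳ x)

  dart′ : ∀ p → Dart′ p
  dart′ p with splitAt 9 p | join-splitAt 9 (nD X) p
  ... | inj₁ i | refl = newDart i
  ... | inj₂ x | refl = oldDart x

  beg-newDart : ∀ i → beg X′ (i ↑ˡ nD X) ≡ newBeg i
  beg-newDart i rewrite splitAt-↑ˡ 9 i (nD X) = refl

  end-newDart : ∀ i → end X′ (i ↑ˡ nD X) ≡ newBeg (newInv i)
  end-newDart i rewrite splitAt-↑ˡ 9 i (nD X) = beg-newDart (newInv i)

  φ′-newDart : ∀ i → φ′ (i ↑ˡ nD X) ≡ newφ i
  φ′-newDart i rewrite splitAt-↑ˡ 9 i (nD X) = refl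

  newDartBetween : Fin (3 ℕ.+ nV X) → Fin (3 ℕ.+ nV X) → Fin 9
  newDartBetween (suc zero)          zero                = # 0
  newDartBetween zero                (suc zero)          = # 1
  newDartBetween (suc (suc zero))    (suc zero)          = # 2
  newDartBetween (suc zero)          (suc (suc zero))    = # 3
  newDartBetween (suc (suc zero))    (suc (suc (suc _))) = # 4
  newDartBetween (suc (suc (suc _))) (suc (suc zero))    = # 5
  newDartBetween zero                zero                = # 6
  newDartBetween (suc zero)          (suc zero)          = # 7
  newDartBetween (suc (suc zero))    (suc (suc zero))    = # 8
  newDartBetween _                   _                   = # 0

  newDartBetween-ends : ∀ i → newDartBetween (newBeg i) (newBeg (newInv i)) ≡ i
  newDartBetween-ends = toWitness {a? = all? λ i → newDartBetween (newBeg i) (newBeg (newInv i)) Fin.≟ i} _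

  newLoop⇒φ≡half : ∀ i → newBeg i ≡ newBeg (newInv i) → newφ i ≡ half
  newLoop⇒φ≡half zero ()
  newLoop⇒φ≡half (suc zero) ()
  newLoop⇒φ≡half (suc (suc zero)) ()
  newLoop⇒φ≡half (suc (suc (suc zero))) ()
  newLoop⇒φ≡half (suc (suc (suc (suc zero)))) ()
  newLoop⇒φ≡half (suc (suc (suc (suc (suc zero))))) ()
  newLoop⇒φ≡half (suc (suc (suc (suc (suc (suc _)))))) _ = refl

  newDart-not-parallel-oldDart : ∀ i x → newBeg i ≡ oldBeg x → newBeg (newInv i) ≡ oldBeg (inv X x) → ⊥
  newDart-not-parallel-oldDart zero x begs _ = oldBeg≢vd x (sym begs)
  newDart-not-parallel-oldDart (suc zero) x _ ends = oldBeg≢vd (inv X x) (sym ends)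
  newDart-not-parallel-oldDart (suc (suc zero)) x begs _ = oldBeg≢ve x (sym begs)
  newDart-not-parallel-oldDart (suc (suc (suc zero))) x begs _ = oldBeg≢vd x (sym begs)
  newDart-not-parallel-oldDart (suc (suc (suc (suc zero)))) x begs _ = oldBeg≢ve x (sym begs)
  newDart-not-parallel-oldDart (suc (suc (suc (suc (suc zero))))) x _ ends = oldBeg≢ve (inv X x) (sym ends)
  newDart-not-parallel-oldDart (suc (suc (suc (suc (suc (suc zero)))))) x begs ends = δ≢δ⁻ (begin
    δ         ≡⟨ inv-inv δ ⟨
    inv X δ⁻  ≡⟨ cong (inv X) (oldBeg≡vc⇒≡δ⁻ x (sym begs)) ⟨
    inv X x   ≡⟨ oldBeg≡vc⇒≡δ⁻ (inv X x) (sym ends) ⟩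
    δ⁻        ∎)
  newDart-not-parallel-oldDart (suc (suc (suc (suc (suc (suc (suc zero))))))) x begs _ = oldBeg≢vd x (sym begs)
  newDart-not-parallel-oldDart (suc (suc (suc (suc (suc (suc (suc (suc zero)))))))) x begs _ = oldBeg≢ve x (sym begs)

  simpleLift′ : D.SimpleLift → D′.SimpleLift
  simpleLift′ (no-null-loop , no-parallel) = no-null-loop′ , no-parallel′
    where
    forget-≡ : ∀ {x y} → oldBeg x ≡ oldBeg y → beg X x ≡ beg X y
    forget-≡ {x} {y} e = trans (sym (forget-oldBeg x)) (trans (cong forget e) (forget-oldBeg y))

    no-null-loop′ : ∀ p → beg X′ p ≡ end X′ p → φ′ p ≢ 0ₙ
    no-null-loop′ p with dart′ p
    ... | oldDart x = λ loop → no-null-loop x (forget-≡ loop)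
    ... | newDart i = λ loop φ′≡0 → half≢0 (begin
      half               ≡⟨ newLoop⇒φ≡half i (trans (sym (beg-newDart i)) (trans loop (end-newDart i))) ⟨
      newφ i             ≡⟨ φ′-newDart i ⟨
      φ′ (i ↑ˡ nD X)     ≡⟨ φ′≡0 ⟩
      0ₙ                 ∎)

    no-parallel′ : ∀ p q → beg X′ p ≡ beg X′ q → end X′ p ≡ end X′ q → φ′ p ≡ φ′ q → p ≡ q
    no-parallel′ p q with dart′ p | dart′ q
    ... | oldDart x | oldDart y = λ begs ends φs → cong (9 ↑ʳ_) (no-parallel x y (forget-≡ begs) (forget-≡ ends) φs)
    ... | newDart i | oldDart x = λ begs ends _ →
      ⊥-elim (newDart-not-parallel-oldDart i x (trans (sym (beg-newDart i)) begs) (trans (sym (end-newDart i)) ends))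
    ... | oldDart x | newDart i = λ begs ends _ →
      ⊥-elim (newDart-not-parallel-oldDart i x (trans (sym (beg-newDart i)) (sym begs)) (trans (sym (end-newDart i)) (sym ends)))
    ... | newDart i | newDart j = λ begs ends _ → cong (_↑ˡ nD X) (begin
      i                                              ≡⟨ newDartBetween-ends i ⟨
      newDartBetween (newBeg i) (newBeg (newInv i))
        ≡⟨ cong₂ newDartBetween (trans (sym (beg-newDart i)) (trans begs (beg-newDart j)))
                                (trans (sym (end-newDart i)) (trans ends (end-newDart j))) ⟩
      newDartBetween (newBeg j) (newBeg (newInv j))  ≡⟨ newDartBetween-ends j ⟩
      j                                              ∎)

lemma15 : (n : ℕ) .{{_ : NonZero n}} → 2 ∣ n
            → (X : PreStructure) → IsPregraph X
            → (φ : Fin (nD X) → Fin n) → IsVoltage X n φ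
            → (a b : Fin (nV X)) → a ≢ b
            → (δ : Fin (nD X)) → beg X δ ≡ a → beg X (inv X δ) ≡ b
            → IsNut (derived X n φ)
            → DifferentMagnitudes X n φ a b
            → IsNut (derived (X₁ X n φ δ b) n (φ₁ X n φ δ b))
lemma15 n 2∣n X X-pregraph φ φ-voltage a b a≢b δ beg-δ end-δ (_ , simple , u , u≢0 , u∈ker , u-spans) magnitudes =
  2≤∣V′∣ , D′.simpleLift⇒simple (simpleLift′ (D.simple⇒simpleLift simple)) , u′ , u′≢0 , u′∈ker , u′-spans
  where
  open EdgeReplacement n 2∣n X X-pregraph φ φ-voltage a b a≢b δ beg-δ end-δ
  open ExtendedNutVector u≢0 u∈ker u-spans (D.NutVector.differentMagnitudes⇒∣orbit∣≢ u≢0 u∈ker u-spans magnitudes)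
  2≤∣V′∣ : 2 ℕ.≤ (3 ℕ.+ nV X) ℕ.* n
  2≤∣V′∣ = ℕ.≤-trans (ℕ.m≤m+n 2 (suc (nV X))) (ℕ.m≤m*n (3 ℕ.+ nV X) n)
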